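{- Let $T$ be a tree that is not a path, rooted at a major vertex $v$, and let $k$ be a positive integer with $k\le\varsigma(T)$. Run the following procedure (Algorithm 2): visit the vertices of $T$ in post-order and assign to each vertex $u$ a pair $(a_u,b_u)$ as follows: (a) if $u$ has no child, set $a_u=1$, $b_u=\infty$; (b) if $u$ has exactly one child $u'$, set $a_u=a_{u'}+1$ (with $\infty+1=\infty$) and $b_u=b_{u'}$; (c) if $u$ has at least two children, set $a_u=\infty$; let $a_{\min}$ be the minimum of the first coordinates $a_{u_i}$ of the pairs assigned to the children $u_i$ of $u$, let $c_u$ be the number of children $u_i$ with $a_{u_i}\ne\infty$, and let $s_u$ be the sum of all second coordinates $b_{u_i}$ of the children with $b_{u_i}\ne\infty$ (an empty sum being $0$); if $c_u\le 1$ set $b_u=s_u$; if $c_u\ge 2$ and $a_{\min}\le\lfloor k/2\rfloor$ set $b_u=a_{\min}+(c_u-1)(k-a_{\min})+s_u$; if $c_u\ge 2$ and $a_{\min}>\lfloor k/2\rfloor$ set $b_u=\lfloor k/2\rfloor+(c_u-1)\lceil k/2\rceil+s_u$. Then $b_v=\dim_k(T)$.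
   Context: For a connected graph $G$, a vertex $w$ distinguishes $u,v$ if $d_G(u,w)\ne d_G(v,w)$. A set $S\subseteq V(G)$ is a $k$-metric generator if every pair of different vertices is distinguished by at least $k$ elements of $S$; a minimum one is a $k$-metric basis and its size is $\dim_k(G)$. In a tree $T$: a major vertex is a vertex of degree at least $3$; a leaf $u$ is a terminal vertex of a major vertex $w$ if $d_T(u,w)<d_T(u,w')$ for every other major vertex $w'$; $\mathrm{ter}(w)$ is the number of terminal vertices of $w$; $\mathcal{M}(T)$ is the set of major vertices $w$ with $\mathrm{ter}(w)\ge 2$. For $w\in\mathcal{M}(T)$ and terminal vertices $u_j\ne u_r$ of $w$, $\varsigma(u_j,u_r)=d_T(u_j,w)+d_T(u_r,w)$; $\varsigma(w)$ is the minimum of $\varsigma(u_j,u_r)$ over pairs of distinct terminal vertices of $w$; and $\varsigma(T)=\min_{w\in\mathcal{M}(T)}\varsigma(w)$. -}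

module Defs where

open import Data.Nat using (ℕ; zero; suc; _+_; _*_; _∸_; _≤_; _<_; _⊓_; ⌊_/2⌋; ⌈_/2⌉; _≤?_; _≟_)
open import Data.List using (List; []; _∷_; length; filter; foldr)
open import Data.List.Relation.Unary.Unique.Propositional using (Unique)
open import Data.Product using (Σ; _×_; _,_; proj₁; proj₂; ∃-syntax)
open import Relation.Nullary using (¬_)
open import Relation.Nullary.Decidable using (¬?)
open import Relation.Binary.PropositionalEquality using (_≡_; _≢_)

-- Finite trees, rooted (at the root of the term).  A tree T rooted at v
-- is represented as a rose tree whose root is v.

data RTree : Set where
  node : List RTree → RTree

-- The vertices of a tree: positions in it.
data Pos : RTree → Set
data PosL : List RTree → Set

data Pos where
  here  : ∀ {ts} → Pos (node ts)
  child : ∀ {ts} → PosL ts → Pos (node ts)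

data PosL where
  hd : ∀ {t ts} → Pos t → PosL (t ∷ ts)
  tl : ∀ {t ts} → PosL ts → PosL (t ∷ ts)

depth  : ∀ {t} → Pos t → ℕ
depthL : ∀ {ts} → PosL ts → ℕ
depth here      = 0
depth (child p) = suc (depthL p)
depthL (hd p) = depth p
depthL (tl p) = depthL p

-- graph distance d_T(u,w): the length of the unique u-w path in the tree
dist  : ∀ {t} → Pos t → Pos t → ℕ
distL : ∀ {ts} → PosL ts → PosL ts → ℕ
dist here      here      = 0
dist here      (child q) = depth (child q)
dist (child p) here      = depth (child p)
dist (child p) (child q) = distL p q
distL (hd p) (hd q) = dist p q
distL (tl p) (tl q) = distL p q
distL (hd p) (tl q) = suc (depth p) + suc (depthL q)
distL (tl p) (hd q) = suc (depthL p) + suc (depth q)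

sub  : ∀ {t} → Pos t → RTree
subL : ∀ {ts} → PosL ts → RTree
sub {t} here = t
sub (child p) = subL p
subL (hd p) = sub p
subL (tl p) = subL p

numChildren : RTree → ℕ
numChildren (node ts) = length ts

-- degree of a vertex in the (unrooted) tree
deg : ∀ {t} → Pos t → ℕ
deg {t} here    = numChildren t
deg (child p)   = suc (numChildren (subL p))

IsLeaf : ∀ {t} → Pos t → Set
IsLeaf u = deg u ≡ 1

IsMajor : ∀ {t} → Pos t → Set
IsMajor w = 3 ≤ deg w

IsTerminal : ∀ {t} → Pos t → Pos t → Set
IsTerminal {t} u w =
  IsMajor w × IsLeaf u ×
  (∀ (w' : Pos t) → IsMajor w' → w' ≢ w → dist u w < dist u w')

-- "k ≤ ς(T)": k is at most ς(u_j,u_r) = d(u_j,w)+d(u_r,w) for every major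
-- vertex w and every pair of distinct terminal vertices u_j, u_r of w
-- (such w are exactly the elements of M(T)); i.e. k ≤ min_w ς(w) = ς(T).
_≤ς_ : ℕ → RTree → Set
k ≤ς t = ∀ (w uj ur : Pos t) → IsTerminal uj w → IsTerminal ur w → uj ≢ ur →
         k ≤ dist uj w + dist ur w

nDist : ∀ {t} → Pos t → Pos t → List (Pos t) → ℕ
nDist u v S = length (filter (λ s → ¬? (dist u s ≟ dist v s)) S)

-- S (a set of vertices, given as a duplicate-free list) is a k-metric generator
IsKMetricGenerator : ℕ → (t : RTree) → List (Pos t) → Set
IsKMetricGenerator k t S =
  Unique S × (∀ (u v : Pos t) → u ≢ v → k ≤ nDist u v S)

IsKMetricDim : ℕ → RTree → ℕ → Set
IsKMetricDim k t m =
  (Σ (List (Pos t)) λ S → IsKMetricGenerator k t S × length S ≡ m) ×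
  (∀ (S : List (Pos t)) → IsKMetricGenerator k t S → m ≤ length S)

data ℕ∞ : Set where
  fin : ℕ → ℕ∞
  ∞   : ℕ∞

suc∞ : ℕ∞ → ℕ∞
suc∞ (fin n) = fin (suc n)
suc∞ ∞       = ∞

finites : List ℕ∞ → List ℕ
finites []            = []
finites (fin n ∷ xs)  = n ∷ finites xs
finites (∞ ∷ xs)      = finites xs

sumℕ : List ℕ → ℕ
sumℕ = foldr _+_ 0

firsts : List (ℕ∞ × ℕ∞) → List ℕ∞
firsts []             = []
firsts ((a , _) ∷ ps) = a ∷ firsts ps

seconds : List (ℕ∞ × ℕ∞) → List ℕ∞
seconds []             = []
seconds ((_ , b) ∷ ps) = b ∷ seconds ps

-- The finite a_{u_i} form the list 'as'; c_u = length as and, when c_u ≥ 1,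
-- a_min is the minimum of 'as' (the infinite ones do not affect the minimum).
bCase : ℕ → List ℕ → ℕ → ℕ
bCase k []              s = s
bCase k (_ ∷ [])        s = s
bCase k as@(x ∷ y ∷ zs) s with foldr _⊓_ x (y ∷ zs) | length as
... | amin | c with amin ≤? ⌊ k /2⌋
...   | Relation.Nullary.yes _ = amin + (c ∸ 1) * (k ∸ amin) + s
...   | Relation.Nullary.no  _ = ⌊ k /2⌋ + (c ∸ 1) * ⌈ k /2⌉ + s

combine : ℕ → List (ℕ∞ × ℕ∞) → ℕ∞ × ℕ∞
combine k []                 = fin 1 , ∞
combine k ((a , b) ∷ [])     = suc∞ a , b
combine k ps@(_ ∷ _ ∷ _)     =
  ∞ , fin (bCase k (finites (firsts ps)) (sumℕ (finites (seconds ps))))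

alg  : ℕ → RTree → ℕ∞ × ℕ∞
algL : ℕ → List RTree → List (ℕ∞ × ℕ∞)
alg k (node ts) = combine k (algL k ts)
algL k []       = []
algL k (t ∷ ts) = alg k t ∷ algL k ts

bRoot : ℕ → RTree → ℕ∞
bRoot k t = proj₂ (alg k t)

root : (t : RTree) → Pos t
root (node ts) = here

NotPath : RTree → Set
NotPath t = Σ (Pos t) IsMajor

module Submission where

-- Upper bound: choose vertices recursively. At a vertex with at least two children take the top
-- vertices of every path child, at most k ∸ a_min of them (or ⌊k/2⌋ from the first path child and
-- ⌈k/2⌉ from the others when a_min > ⌊k/2⌋), and recurse into the other children. Since k ≤ ς(T),
-- the lengths of two path children of a vertex add up to at least k, hence so do the numbers of
-- vertices chosen in any two child subtrees. Two vertices at equal depth in different child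
-- subtrees are told apart by every chosen vertex of either subtree; a shallower vertex and a deeper
-- one are told apart by every chosen vertex outside the root branch of the deeper one, and the root
-- has at least three branches.
--
-- Lower bound: two children of a vertex are told apart only by vertices of their two subtrees, so a
-- k-metric generator has at least k vertices there. It has at most a vertices in a path child with
-- a vertices and, inductively, at least b_u in the subtree of any other child u; minimising the
-- total under these constraints gives b_v.

open import Defs
open import Data.Bool using (true; false)
open import Data.Empty using (⊥; ⊥-elim)
import Data.Fin as Fin
import Data.Fin.Properties as Fin
open import Data.List using (List; []; _∷_; length; filter; map; _++_; mapMaybe; foldr)
open import Data.List.Properties
  using (length-++; filter-++; filter-all; filter-≐; length-map; length-mapMaybe; mapMaybe-cong; mapMaybe-just)
open import Data.List.Membership.Propositional using (_∈_; mapWith∈)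
open import Data.List.Membership.Propositional.Properties using (mapWith∈≗map; mapWith∈-cong; ∈-map⁻)
open import Data.List.Relation.Binary.Pointwise using (Pointwise; []; _∷_; Pointwise-length)
open import Data.List.Relation.Unary.All as All using (All; []; _∷_)
open import Data.List.Relation.Unary.All.Properties as All using ()
open import Data.List.Relation.Unary.AllPairs using (AllPairs; []; _∷_)
open import Data.List.Relation.Unary.Any using (here; there; index)
open import Data.List.Relation.Unary.Unique.Propositional using (Unique)
import Data.List.Relation.Unary.Unique.Propositional.Properties as Unique
open import Data.Maybe using (Maybe; just; nothing; Is-just; _>>=_)
open import Data.Maybe.Properties using (just-injective)
open import Data.Maybe.Relation.Unary.Any using () renaming (just to is-just)
open import Data.Nat
open import Data.Nat.Properties
open import Algebra.Properties.CommutativeSemigroup +-commutativeSemigroup using (x∙yz≈y∙xz)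
open import Data.Product using (Σ; _×_; _,_; proj₁; proj₂; ∃-syntax)
open import Data.Sum using (_⊎_; inj₁; inj₂; swap)
open import Data.Unit using (⊤; tt)
open import Function using (_∘_)
open import Level using (0ℓ)
open import Relation.Binary using (tri<; tri≈; tri>)
open import Relation.Binary.PropositionalEquality
open import Relation.Nullary using (¬_; yes; no; does)
open import Relation.Nullary.Decidable using (¬?)
open import Relation.Unary using (Pred; Decidable)

count : ∀ {A : Set} {P : Pred A 0ℓ} → Decidable P → List A → ℕ
count P? xs = length (filter P? xs)

module _ {A : Set} {P : Pred A 0ℓ} (P? : Decidable P) where

  count-++ : ∀ xs ys → count P? (xs ++ ys) ≡ count P? xs + count P? ys
  count-++ xs ys = trans (cong length (filter-++ P? xs ys)) (length-++ (filter P? xs))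

  count-universal : (∀ x → P x) → ∀ xs → count P? xs ≡ length xs
  count-universal u xs = cong length (filter-all P? (All.universal u xs))

  count-map : ∀ {B : Set} (f : B → A) xs → count P? (map f xs) ≡ count (P? ∘ f) xs
  count-map f []       = refl
  count-map f (x ∷ xs) with does (P? (f x))
  ... | true  = cong suc (count-map f xs)
  ... | false = count-map f xs

module _ {A B : Set} (f : A → Maybe B) where

  length-mapMaybe-∷ : ∀ x xs → length (mapMaybe f xs) ≤ length (mapMaybe f (x ∷ xs))
  length-mapMaybe-∷ x xs with f x
  ... | just _  = n≤1+n _
  ... | nothing = ≤-refl

  unique-mapMaybe : (∀ {x y z} → f x ≡ just z → f y ≡ just z → x ≡ y) →
    ∀ {xs} → Unique xs → Unique (mapMaybe f xs)
  unique-mapMaybe inj {[]}     []          = []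
  unique-mapMaybe inj {x ∷ xs} (x∉xs ∷ u) with f x in fx
  ... | nothing = unique-mapMaybe inj u
  ... | just z  = fresh xs x∉xs ∷ unique-mapMaybe inj u
    where
    fresh : ∀ ys → All (x ≢_) ys → All (z ≢_) (mapMaybe f ys)
    fresh []       []        = []
    fresh (y ∷ ys) (x≢y ∷ h) with f y in fy
    ... | nothing = fresh ys h
    ... | just w  = (λ z≡w → x≢y (inj fx (trans fy (cong just (sym z≡w))))) ∷ fresh ys h

  length-≤-suc-mapMaybe : (∀ {x y} → f x ≡ nothing → f y ≡ nothing → x ≡ y) →
    ∀ {xs} → Unique xs → length xs ≤ suc (length (mapMaybe f xs))
  length-≤-suc-mapMaybe once {[]}     []          = z≤n
  length-≤-suc-mapMaybe once {x ∷ xs} (x∉xs ∷ u) with f x in fx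
  ... | just _  = s≤s (length-≤-suc-mapMaybe once u)
  ... | nothing = s≤s (allDefined xs x∉xs)
    where
    allDefined : ∀ ys → All (x ≢_) ys → length ys ≤ length (mapMaybe f ys)
    allDefined []       []        = z≤n
    allDefined (y ∷ ys) (x≢y ∷ h) with f y in fy
    ... | just _  = s≤s (allDefined ys h)
    ... | nothing = ⊥-elim (x≢y (once fx fy))

mapMaybe->>= : ∀ {A B C : Set} (f : A → Maybe B) (g : B → Maybe C) xs →
  mapMaybe (λ x → f x >>= g) xs ≡ mapMaybe g (mapMaybe f xs)
mapMaybe->>= f g []       = refl
mapMaybe->>= f g (x ∷ xs) with f x
... | nothing = mapMaybe->>= f g xs
... | just y with g y
...   | nothing = mapMaybe->>= f g xs
...   | just z  = cong (z ∷_) (mapMaybe->>= f g xs)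

module _ {A B C : Set} {P : Pred A 0ℓ} (P? : Decidable P) (f : A → Maybe B) (g : A → Maybe C) where

  count-≤-mapMaybe₂ : (∀ x → P x → Is-just (f x) ⊎ Is-just (g x)) → ∀ xs →
    count P? xs ≤ length (mapMaybe f xs) + length (mapMaybe g xs)
  count-≤-mapMaybe₂ h []       = z≤n
  count-≤-mapMaybe₂ h (x ∷ xs) with ih ← count-≤-mapMaybe₂ h xs | P? x
  ... | no _ = ≤-trans ih (+-mono-≤ (length-mapMaybe-∷ f x xs) (length-mapMaybe-∷ g x xs))
  ... | yes px with f x in fx
  ...   | just _  = s≤s (≤-trans ih (+-monoʳ-≤ _ (length-mapMaybe-∷ g x xs)))
  ...   | nothing with g x | h x px
  ...     | just _  | _      = ≤-trans (s≤s ih) (≤-reflexive (sym (+-suc _ _)))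
  ...     | nothing | inj₁ j with () ← subst Is-just fx j
  ...     | nothing | inj₂ ()

∈⇒1≤length : ∀ {A : Set} {y : A} {xs} → y ∈ xs → 1 ≤ length xs
∈⇒1≤length (here _)  = s≤s z≤n
∈⇒1≤length (there _) = s≤s z≤n

index-distinct⇒2≤length : ∀ {A : Set} {x y : A} {xs} (σ : x ∈ xs) (τ : y ∈ xs) → index σ ≢ index τ →
  2 ≤ length xs
index-distinct⇒2≤length (here _)  (here _)  ne = ⊥-elim (ne refl)
index-distinct⇒2≤length (here _)  (there τ) ne = s≤s (∈⇒1≤length τ)
index-distinct⇒2≤length (there σ) (here _)  ne = s≤s (∈⇒1≤length σ)
index-distinct⇒2≤length (there σ) (there τ) ne = m≤n⇒m≤1+n (index-distinct⇒2≤length σ τ (ne ∘ cong Fin.suc))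

module _ {A B : Set} where

  all-mapWith∈ : ∀ {P : B → Set} {xs : List A} {f : ∀ {x} → x ∈ xs → B} →
    (∀ {x} (σ : x ∈ xs) → P (f σ)) → All P (mapWith∈ xs f)
  all-mapWith∈ {xs = []}     h = []
  all-mapWith∈ {xs = x ∷ xs} h = h (here refl) ∷ all-mapWith∈ (h ∘ there)

  allPairs-mapWith∈ : ∀ {R : B → B → Set} {xs : List A} (f : ∀ {x} → x ∈ xs → B) →
    (∀ {x y} (σ : x ∈ xs) (τ : y ∈ xs) → index σ ≢ index τ → R (f σ) (f τ)) → AllPairs R (mapWith∈ xs f)
  allPairs-mapWith∈ {xs = []}     f h = []
  allPairs-mapWith∈ {xs = x ∷ xs} f h =
    all-mapWith∈ (λ τ → h (here refl) (there τ) λ ()) ∷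
    allPairs-mapWith∈ (f ∘ there) (λ σ τ ne → h (there σ) (there τ) (ne ∘ Fin.suc-injective))

  pointwise-mapWith∈ : ∀ {C : Set} {R : C → B → Set} {g : A → C} xs (f : ∀ {x} → x ∈ xs → B) →
    (∀ {x} (σ : x ∈ xs) → R (g x) (f σ)) → Pointwise R (map g xs) (mapWith∈ xs f)
  pointwise-mapWith∈ []       f h = []
  pointwise-mapWith∈ (x ∷ xs) f h = h (here refl) ∷ pointwise-mapWith∈ xs (f ∘ there) (h ∘ there)

-- Distances in rooted trees

treeInduction : (P : RTree → Set) → (∀ {ts} → All P ts → P (node ts)) → ∀ t → P t
treeInduction P step (node ts) = step (children ts)
  where
  children : ∀ ts → All P ts
  children []       = []
  children (t ∷ ts) = treeInduction P step t ∷ children ts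

dist≤depth+depth  : ∀ {t} (u s : Pos t) → dist u s ≤ depth u + depth s
distL≤depth+depth : ∀ {ts} (p s : PosL ts) → distL p s ≤ suc (depthL p) + suc (depthL s)
dist≤depth+depth here      here      = z≤n
dist≤depth+depth here      (child s) = ≤-refl
dist≤depth+depth (child p) here      = m≤m+n _ _
dist≤depth+depth (child p) (child s) = distL≤depth+depth p s
distL≤depth+depth (hd p) (hd s) = ≤-trans (dist≤depth+depth p s) (+-mono-≤ (n≤1+n _) (n≤1+n _))
distL≤depth+depth (hd p) (tl s) = ≤-refl
distL≤depth+depth (tl p) (hd s) = ≤-refl
distL≤depth+depth (tl p) (tl s) = distL≤depth+depth p s

dist≡0⇒≡  : ∀ {t} (u v : Pos t) → dist u v ≡ 0 → u ≡ v
distL≡0⇒≡ : ∀ {ts} (p q : PosL ts) → distL p q ≡ 0 → p ≡ q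
dist≡0⇒≡ here      here      _ = refl
dist≡0⇒≡ (child p) (child q) e = cong child (distL≡0⇒≡ p q e)
distL≡0⇒≡ (hd p) (hd q) e = cong hd (dist≡0⇒≡ p q e)
distL≡0⇒≡ (tl p) (tl q) e = cong tl (distL≡0⇒≡ p q e)

dist-here : ∀ {ts} (z : Pos (node ts)) → dist here z ≡ depth z
dist-here here      = refl
dist-here (child p) = refl

child-injective : ∀ {ts} {p q : PosL ts} → child p ≡ child q → p ≡ q
child-injective refl = refl

SameBranch : ∀ {ts} → PosL ts → PosL ts → Set
SameBranch (hd _) (hd _) = ⊤
SameBranch (hd _) (tl _) = ⊥
SameBranch (tl _) (hd _) = ⊥
SameBranch (tl p) (tl q) = SameBranch p q

sameBranch-join : ∀ {ts} (p q s : PosL ts) → SameBranch p s → SameBranch q s → SameBranch p q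
sameBranch-join (hd _) (hd _) (hd _) _  _  = tt
sameBranch-join (tl p) (tl q) (tl s) ps qs = sameBranch-join p q s ps qs

distL-sameBranch : ∀ {ts} (p s : PosL ts) → SameBranch p s → distL p s ≤ depthL p + depthL s
distL-sameBranch (hd p) (hd s) _ = dist≤depth+depth p s
distL-sameBranch (tl p) (tl s) b = distL-sameBranch p s b

distL-otherBranch : ∀ {ts} (p s : PosL ts) → ¬ SameBranch p s → distL p s ≡ suc (depthL p) + suc (depthL s)
distL-otherBranch (hd p) (hd s) nb = ⊥-elim (nb tt)
distL-otherBranch (hd p) (tl s) nb = refl
distL-otherBranch (tl p) (hd s) nb = refl
distL-otherBranch (tl p) (tl s) nb = distL-otherBranch p s nb

distL-sameBranch-< : ∀ {ts} (u v s : PosL ts) → depthL u ≤ depthL v → SameBranch u s → ¬ SameBranch v s →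
  distL u s < distL v s
distL-sameBranch-< u v s du≤dv us ¬vs = begin-strict
  distL u s                       ≤⟨ distL-sameBranch u s us ⟩
  depthL u + depthL s             <⟨ s≤s (+-mono-≤ du≤dv (n≤1+n _)) ⟩
  suc (depthL v) + suc (depthL s) ≡⟨ sym (distL-otherBranch v s ¬vs) ⟩
  distL v s                       ∎
  where open ≤-Reasoning

dist-<-otherBranch : ∀ {ts} (u : Pos (node ts)) q s → depth u ≤ depthL q → ¬ SameBranch q s →
  dist u (child s) < distL q s
dist-<-otherBranch u q s du≤dq ¬qs = begin-strict
  dist u (child s)                ≤⟨ dist≤depth+depth u (child s) ⟩
  depth u + suc (depthL s)        ≤⟨ +-monoˡ-≤ _ du≤dq ⟩
  depthL q + suc (depthL s)       <⟨ ≤-refl ⟩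
  suc (depthL q) + suc (depthL s) ≡⟨ sym (distL-otherBranch q s ¬qs) ⟩
  distL q s                       ∎
  where open ≤-Reasoning

embed : ∀ {t ts} → t ∈ ts → Pos t → PosL ts
embed (here refl) y = hd y
embed (there σ)   y = tl (embed σ y)

restrictL : ∀ {t ts} → t ∈ ts → PosL ts → Maybe (Pos t)
restrictL (here refl) (hd y) = just y
restrictL (here refl) (tl _) = nothing
restrictL (there σ)   (hd _) = nothing
restrictL (there σ)   (tl p) = restrictL σ p

restrict : ∀ {t ts} → t ∈ ts → Pos (node ts) → Maybe (Pos t)
restrict σ here      = nothing
restrict σ (child p) = restrictL σ p

depthL-embed : ∀ {t ts} (σ : t ∈ ts) y → depthL (embed σ y) ≡ depth y
depthL-embed (here refl) y = refl
depthL-embed (there σ)   y = depthL-embed σ y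

distL-embed : ∀ {t ts} (σ : t ∈ ts) y z → distL (embed σ y) (embed σ z) ≡ dist y z
distL-embed (here refl) y z = refl
distL-embed (there σ)   y z = distL-embed σ y z

subL-embed : ∀ {t ts} (σ : t ∈ ts) y → subL (embed σ y) ≡ sub y
subL-embed (here refl) y = refl
subL-embed (there σ)   y = subL-embed σ y

restrictL-embed : ∀ {t ts} (σ : t ∈ ts) y → restrictL σ (embed σ y) ≡ just y
restrictL-embed (here refl) y = refl
restrictL-embed (there σ)   y = restrictL-embed σ y

embed-restrictL : ∀ {t ts} (σ : t ∈ ts) p {y} → restrictL σ p ≡ just y → embed σ y ≡ p
embed-restrictL (here refl) (hd _) refl = refl
embed-restrictL (there σ)   (tl p) e    = cong tl (embed-restrictL σ p e)

child-restrict : ∀ {t ts} (σ : t ∈ ts) z {y} → restrict σ z ≡ just y → child (embed σ y) ≡ z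
child-restrict σ (child p) e = cong child (embed-restrictL σ p e)

restrictL-otherBranch : ∀ {t ts} (σ : t ∈ ts) y p → restrictL σ p ≡ nothing → ¬ SameBranch (embed σ y) p
restrictL-otherBranch (here refl) y (hd _) () _
restrictL-otherBranch (there σ)   y (tl p) e  b = restrictL-otherBranch σ y p e b

restrictL-sibling : ∀ {t t' ts} (σ : t ∈ ts) (τ : t' ∈ ts) → index σ ≢ index τ → ∀ y →
  restrictL σ (embed τ y) ≡ nothing
restrictL-sibling (here refl) (here refl) ne y = ⊥-elim (ne refl)
restrictL-sibling (here refl) (there τ)   ne y = refl
restrictL-sibling (there σ)   (here refl) ne y = refl
restrictL-sibling (there σ)   (there τ)   ne y = restrictL-sibling σ τ (ne ∘ cong Fin.suc) y

embed-sibling : ∀ {t t' ts} (σ : t ∈ ts) (τ : t' ∈ ts) → index σ ≢ index τ → ∀ y z → embed σ y ≢ embed τ z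
embed-sibling σ τ ne y z e
  with () ← trans (sym (restrictL-embed σ y)) (trans (cong (restrictL σ) e) (restrictL-sibling σ τ ne z))

dist-child-outside : ∀ {t ts} (σ : t ∈ ts) y z → restrict σ z ≡ nothing →
  dist (child (embed σ y)) z ≡ suc (depth y + depth z)
dist-child-outside σ y here      _ = cong suc (trans (depthL-embed σ y) (sym (+-identityʳ (depth y))))
dist-child-outside σ y (child p) e =
  trans (distL-otherBranch (embed σ y) p (restrictL-otherBranch σ y p e))
        (cong (λ d → suc d + suc (depthL p)) (depthL-embed σ y))

-- A subtree of T together with its position: the zipper of the rose tree.
data Ctx (T : RTree) : RTree → Set where
  top  : Ctx T T
  down : ∀ {t ts} → Ctx T (node ts) → t ∈ ts → Ctx T t

plug : ∀ {T t} → Ctx T t → Pos t → Pos T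
plug top        y = y
plug (down c σ) y = plug c (child (embed σ y))

unplug : ∀ {T t} → Ctx T t → Pos T → Maybe (Pos t)
unplug top        w = just w
unplug (down c σ) w = unplug c w >>= restrict σ

dist-plug : ∀ {T t} (c : Ctx T t) y z → dist (plug c y) (plug c z) ≡ dist y z
dist-plug top        y z = refl
dist-plug (down c σ) y z = trans (dist-plug c _ _) (distL-embed σ y z)

unplug-plug : ∀ {T t} (c : Ctx T t) y → unplug c (plug c y) ≡ just y
unplug-plug top        y = refl
unplug-plug (down c σ) y rewrite unplug-plug c (child (embed σ y)) = restrictL-embed σ y

plug-unplug : ∀ {T t} (c : Ctx T t) w {y} → unplug c w ≡ just y → plug c y ≡ w
plug-unplug top        w refl = refl
plug-unplug (down c σ) w e with unplug c w in ew
... | just (child p) = trans (cong (plug c ∘ child) (embed-restrictL σ p e)) (plug-unplug c w ew)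

plug-injective : ∀ {T t} (c : Ctx T t) {y z} → plug c y ≡ plug c z → y ≡ z
plug-injective c {y} {z} e =
  just-injective (trans (sym (unplug-plug c y)) (trans (cong (unplug c) e) (unplug-plug c z)))

deg-plug-child : ∀ {T ts} (c : Ctx T (node ts)) p → deg (plug c (child p)) ≡ suc (numChildren (subL p))
deg-plug-child top        p = refl
deg-plug-child (down c σ) p =
  trans (deg-plug-child c (embed σ (child p))) (cong (suc ∘ numChildren) (subL-embed σ (child p)))

deg-plug-down : ∀ {T t ts} (c : Ctx T (node ts)) (σ : t ∈ ts) y → deg (plug (down c σ) y) ≡ suc (numChildren (sub y))
deg-plug-down c σ y = trans (deg-plug-child c (embed σ y)) (cong (suc ∘ numChildren) (subL-embed σ y))

dist-down-root : ∀ {T ts t} (c : Ctx T (node ts)) (σ : t ∈ ts) y → dist (plug (down c σ) y) (plug c here) ≡ suc (depth y)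
dist-down-root c σ y = trans (dist-plug c (child (embed σ y)) here) (cong suc (depthL-embed σ y))

dist-plug-outside : ∀ {T us} (c : Ctx T (node us)) w → unplug c w ≡ nothing → ∀ y →
  dist (plug c y) w ≡ depth y + dist (plug c here) w
dist-plug-outside (down c σ) w e y with unplug c w in ew
... | nothing
  rewrite dist-plug-outside c w ew (child (embed σ y)) | dist-plug-outside c w ew (child (embed σ here))
        | depthL-embed σ y | depthL-embed σ here = sym (+-suc (depth y) _)
... | just z
  rewrite sym (plug-unplug c w ew) | dist-plug c (child (embed σ y)) z | dist-plug c (child (embed σ here)) z
        | dist-child-outside σ y z e | dist-child-outside σ here z e = sym (+-suc (depth y) (depth z))

dist-childRoot-outside : ∀ {T ts us} (c : Ctx T (node ts)) (σ : node us ∈ ts) s → unplug (down c σ) s ≡ nothing →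
  dist (plug (down c σ) here) s ≡ suc (dist (plug c here) s)
dist-childRoot-outside c σ s e with unplug c s in es
... | nothing rewrite dist-plug-outside c s es (child (embed σ here)) | depthL-embed σ here = refl
... | just z
  rewrite sym (plug-unplug c s es) | dist-plug c (child (embed σ here)) z | dist-plug c here z
        | dist-child-outside σ here z e | dist-here z = refl

data IsPath : RTree → ℕ → Set where
  leaf : IsPath (node []) 1
  cons : ∀ {t a} → IsPath t a → IsPath (node (t ∷ [])) (suc a)

alg-path⊎branching : ∀ k t → (∃[ a ] IsPath t a × alg k t ≡ (fin a , ∞)) ⊎ (∃[ b ] alg k t ≡ (∞ , fin b))
alg-path⊎branching k (node [])          = inj₁ (1 , leaf , refl)
alg-path⊎branching k (node (t ∷ []))    with alg-path⊎branching k t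
... | inj₁ (a , p , e) rewrite e = inj₁ (suc a , cons p , refl)
... | inj₂ (b , e)     rewrite e = inj₂ (b , refl)
alg-path⊎branching k (node (_ ∷ _ ∷ _)) = inj₂ (_ , refl)

algL≡map : ∀ k ts → algL k ts ≡ map (alg k) ts
algL≡map k []       = refl
algL≡map k (t ∷ ts) = cong (alg k t ∷_) (algL≡map k ts)

firsts-algL : ∀ k ts → firsts (algL k ts) ≡ map (proj₁ ∘ alg k) ts
firsts-algL k []       = refl
firsts-algL k (t ∷ ts) = cong (proj₁ (alg k t) ∷_) (firsts-algL k ts)

path-end : ∀ {t a} → IsPath t a → Σ (Pos t) λ y → suc (depth y) ≡ a × numChildren (sub y) ≡ 0
path-end leaf     = here , refl , refl
path-end (cons p) with path-end p
... | y , dy , ly = child (hd y) , cong suc dy , ly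

path-numChildren≤1 : ∀ {t a} → IsPath t a → (z : Pos t) → numChildren (sub z) ≤ 1
path-numChildren≤1 leaf     here           = z≤n
path-numChildren≤1 (cons p) here           = s≤s z≤n
path-numChildren≤1 (cons p) (child (hd z)) = path-numChildren≤1 p z

path-depth-injective : ∀ {t a} → IsPath t a → (u v : Pos t) → depth u ≡ depth v → u ≡ v
path-depth-injective _        here           here           _ = refl
path-depth-injective (cons p) (child (hd u)) (child (hd v)) e =
  cong (child ∘ hd) (path-depth-injective p u v (suc-injective e))

unique-≤-pathLength : ∀ {t a} → IsPath t a → {Y : List (Pos t)} → Unique Y → length Y ≤ a
unique-≤-pathLength leaf {[]}              _                     = z≤n
unique-≤-pathLength leaf {_ ∷ []}          _                     = ≤-refl
unique-≤-pathLength leaf {here ∷ here ∷ _} ((here≢here ∷ _) ∷ _) = ⊥-elim (here≢here refl)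
unique-≤-pathLength (cons p) u = ≤-trans
  (length-≤-suc-mapMaybe (restrict (here refl)) rootOnly u)
  (s≤s (unique-≤-pathLength p (unique-mapMaybe (restrict (here refl)) restrict-injective u)))
  where
  rootOnly : ∀ {x y} → restrict (here refl) x ≡ nothing → restrict (here refl) y ≡ nothing → x ≡ y
  rootOnly {here}          {here}          _  _  = refl
  rootOnly {here}          {child (hd _)}  _  ()
  rootOnly {here}          {child (tl ())}
  rootOnly {child (hd _)}  {_}             () _
  rootOnly {child (tl ())}
  restrict-injective : ∀ {x y z} → restrict (here refl) x ≡ just z → restrict (here refl) y ≡ just z → x ≡ y
  restrict-injective {x} {y} ex ey = trans (sym (child-restrict (here refl) x ex)) (child-restrict (here refl) y ey)

-- The local ς condition

PairSums≥ : ℕ → List ℕ → Set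
PairSums≥ k = AllPairs (λ a b → k ≤ a + b)

pathLengths : ℕ → List RTree → List ℕ
pathLengths k ts = finites (firsts (algL k ts))

data _≤ς-locally_ (k : ℕ) : RTree → Set where
  node : ∀ {ts} → PairSums≥ k (pathLengths k ts) → All (k ≤ς-locally_) ts → k ≤ς-locally node ts

PathPairSum≥ : ℕ → ℕ∞ → ℕ∞ → Set
PathPairSum≥ k (fin a) (fin b) = k ≤ a + b
PathPairSum≥ k _       _       = ⊤

pairSums-finites : ∀ {k xs} → AllPairs (PathPairSum≥ k) xs → PairSums≥ k (finites xs)
pairSums-finites {xs = []}         []       = []
pairSums-finites {xs = ∞ ∷ xs}     (_ ∷ ps) = pairSums-finites ps
pairSums-finites {xs = fin a ∷ xs} (p ∷ ps) = finitesAll xs p ∷ pairSums-finites ps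
  where
  finitesAll : ∀ ys → All (PathPairSum≥ _ (fin a)) ys → All (λ b → _ ≤ a + b) (finites ys)
  finitesAll []           []       = []
  finitesAll (fin _ ∷ ys) (q ∷ qs) = q ∷ finitesAll ys qs
  finitesAll (∞ ∷ ys)     (_ ∷ qs) = finitesAll ys qs

module LocalςBound {T : RTree} {k : ℕ} (k≤ςT : k ≤ς T) where

  pathEnd-terminal : ∀ {ts us a} (c : Ctx T (node ts)) (σ : node us ∈ ts) → IsMajor (plug c here) →
    IsPath (node us) a → ∀ y → numChildren (sub y) ≡ 0 → IsTerminal (plug (down c σ) y) (plug c here)
  pathEnd-terminal c σ major p y leafy = major , trans (deg-plug-down c σ y) (cong suc leafy) , nearer
    where
    nearer : ∀ w → IsMajor w → w ≢ plug c here →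
      dist (plug (down c σ) y) (plug c here) < dist (plug (down c σ) y) w
    nearer w major-w w≢root with unplug (down c σ) w in ew
    ... | just z = ⊥-elim (<⇒≱ (s≤s (s≤s (path-numChildren≤1 p z)))
                     (subst (3 ≤_) (deg-plug-down c σ z) (subst IsMajor (sym (plug-unplug (down c σ) w ew)) major-w)))
    ... | nothing = begin-strict
      dist (plug (down c σ) y) (plug c here)  ≡⟨ dist-down-root c σ y ⟩
      suc (depth y)                           <⟨ s≤s (m<m+n (depth y) (n≢0⇒n>0 (w≢root ∘ sym ∘ dist≡0⇒≡ _ w))) ⟩
      suc (depth y + dist (plug c here) w)    ≡⟨ sym (+-suc (depth y) _) ⟩
      depth y + suc (dist (plug c here) w)    ≡⟨ cong (depth y +_) (sym (dist-childRoot-outside c σ w ew)) ⟩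
      depth y + dist (plug (down c σ) here) w ≡⟨ sym (dist-plug-outside (down c σ) w ew y) ⟩
      dist (plug (down c σ) y) w              ∎
      where open ≤-Reasoning

  -- The deepest vertices of two path children of a major vertex are distinct terminal vertices of it.
  pathChildren-pairSum : ∀ {ts us us' a b} (c : Ctx T (node ts)) → IsMajor (plug c here) →
    (σ : node us ∈ ts) (τ : node us' ∈ ts) → index σ ≢ index τ → IsPath (node us) a → IsPath (node us') b →
    k ≤ a + b
  pathChildren-pairSum c major σ τ ne p q with path-end p | path-end q
  ... | y , dy , leafy | z , dz , leafz =
    subst (k ≤_) (cong₂ _+_ (trans (dist-down-root c σ y) dy) (trans (dist-down-root c τ z) dz))
      (k≤ςT (plug c here) (plug (down c σ) y) (plug (down c τ) z)
        (pathEnd-terminal c σ major p y leafy) (pathEnd-terminal c τ major q z leafz)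
        (embed-sibling σ τ ne y z ∘ child-injective ∘ plug-injective c))

  LocalAt : RTree → Set
  LocalAt t = (c : Ctx T t) → (2 ≤ numChildren t → IsMajor (plug c (root t))) → k ≤ς-locally t

  local : ∀ t → LocalAt t
  local = treeInduction LocalAt step
    where
    step : ∀ {ts} → All LocalAt ts → LocalAt (node ts)
    step {ts} ih c major = node
      (pairSums-finites (subst (AllPairs (PathPairSum≥ k))
        (sym (trans (firsts-algL k ts) (sym (mapWith∈≗map (proj₁ ∘ alg k) ts))))
        (allPairs-mapWith∈ (λ {t} _ → proj₁ (alg k t)) pair)))
      (All.tabulate λ { {node us} σ → All.lookup ih σ (down c σ) λ 2≤ →
        subst (3 ≤_) (sym (deg-plug-down c σ here)) (s≤s 2≤) })
      where
      pair : ∀ {t t'} (σ : t ∈ ts) (τ : t' ∈ ts) → index σ ≢ index τ →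
        PathPairSum≥ k (proj₁ (alg k t)) (proj₁ (alg k t'))
      pair {node us} {node us'} σ τ ne with alg-path⊎branching k (node us) | alg-path⊎branching k (node us')
      ... | inj₁ (a , p , e) | inj₁ (b , q , e') rewrite e | e' =
        pathChildren-pairSum c (major (index-distinct⇒2≤length σ τ ne)) σ τ ne p q
      ... | inj₁ (a , p , e) | inj₂ (b , e')     rewrite e | e' = tt
      ... | inj₂ (a , e)     | _                 rewrite e = tt

-- Arithmetic of b_u

⌈n/2⌉≤1+⌊n/2⌋ : ∀ n → ⌈ n /2⌉ ≤ suc ⌊ n /2⌋
⌈n/2⌉≤1+⌊n/2⌋ zero          = z≤n
⌈n/2⌉≤1+⌊n/2⌋ (suc zero)    = ≤-refl
⌈n/2⌉≤1+⌊n/2⌋ (suc (suc n)) = s≤s (⌈n/2⌉≤1+⌊n/2⌋ n)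

n∸⌊n/2⌋≡⌈n/2⌉ : ∀ n → n ∸ ⌊ n /2⌋ ≡ ⌈ n /2⌉
n∸⌊n/2⌋≡⌈n/2⌉ n = trans (cong (_∸ ⌊ n /2⌋) (sym (⌊n/2⌋+⌈n/2⌉≡n n))) (m+n∸m≡n ⌊ n /2⌋ ⌈ n /2⌉)

n≤⌈n/2⌉+⌈n/2⌉ : ∀ n → n ≤ ⌈ n /2⌉ + ⌈ n /2⌉
n≤⌈n/2⌉+⌈n/2⌉ n =
  subst (_≤ ⌈ n /2⌉ + ⌈ n /2⌉) (⌊n/2⌋+⌈n/2⌉≡n n) (+-monoˡ-≤ ⌈ n /2⌉ (⌊n/2⌋≤⌈n/2⌉ n))

m≤⌊n/2⌋⇒m≤n∸m : ∀ {m} n → m ≤ ⌊ n /2⌋ → m ≤ n ∸ m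
m≤⌊n/2⌋⇒m≤n∸m n m≤h =
  ≤-trans m≤h (≤-trans (subst (⌊ n /2⌋ ≤_) (sym (n∸⌊n/2⌋≡⌈n/2⌉ n)) (⌊n/2⌋≤⌈n/2⌉ n))
                       (∸-monoʳ-≤ n m≤h))

minOf : ℕ → List ℕ → ℕ
minOf x xs = foldr _⊓_ x xs

minOf≤head : ∀ x xs → minOf x xs ≤ x
minOf≤head x []       = ≤-refl
minOf≤head x (y ∷ ys) = ≤-trans (m⊓n≤n y _) (minOf≤head x ys)

minOf≤tail : ∀ x xs → All (minOf x xs ≤_) xs
minOf≤tail x []       = []
minOf≤tail x (y ∷ ys) = m⊓n≤m y _ ∷ All.map (≤-trans (m⊓n≤n y _)) (minOf≤tail x ys)

minOf-greatest : ∀ {m x xs} → m ≤ x → All (m ≤_) xs → m ≤ minOf x xs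
minOf-greatest m≤x []         = m≤x
minOf-greatest m≤x (m≤y ∷ hs) = ⊓-glb m≤y (minOf-greatest m≤x hs)

minOf-mono : ∀ {n a ns as} → n ≤ a → Pointwise _≤_ ns as → minOf n ns ≤ minOf a as
minOf-mono n≤a []       = n≤a
minOf-mono n≤a (h ∷ hs) = ⊓-mono-≤ h (minOf-mono n≤a hs)

length*≤sum : ∀ {c} xs → All (c ≤_) xs → length xs * c ≤ sumℕ xs
length*≤sum []       []       = z≤n
length*≤sum (x ∷ xs) (h ∷ hs) = +-mono-≤ h (length*≤sum xs hs)

pairSums≤sum : ∀ {k xs} → 2 ≤ length xs → PairSums≥ k xs → k ≤ sumℕ xs
pairSums≤sum {xs = x ∷ []}    (s≤s ())
pairSums≤sum {xs = x ∷ y ∷ _} _ ((k≤x+y ∷ _) ∷ _) = ≤-trans k≤x+y (+-monoʳ-≤ x (m≤m+n y _))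

-- b_u of case (c) when c_u ≥ 2, as a function of a_min and c_u ∸ 1.
branchCost : ℕ → ℕ → ℕ → ℕ
branchCost k m d with m ≤? ⌊ k /2⌋
... | yes _ = m + d * (k ∸ m)
... | no  _ = ⌊ k /2⌋ + d * ⌈ k /2⌉

-- The part of b_u due to the path children, whose lengths are the argument.
pathCost : ℕ → List ℕ → ℕ
pathCost k (x ∷ y ∷ zs) = branchCost k (minOf x (y ∷ zs)) (suc (length zs))
pathCost k _            = 0

bCase≡pathCost+ : ∀ k as s → bCase k as s ≡ pathCost k as + s
bCase≡pathCost+ k []           s = refl
bCase≡pathCost+ k (x ∷ [])     s = refl
bCase≡pathCost+ k (x ∷ y ∷ zs) s with foldr _⊓_ x (y ∷ zs) ≤? ⌊ k /2⌋
... | yes _ = refl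
... | no  _ = refl

-- The number b_u, with ∞ read as 0 (as in s_u, which ignores infinite b's).
bValue : ℕ∞ × ℕ∞ → ℕ
bValue (_ , fin b) = b
bValue (_ , ∞)     = 0

bValue-combine : ∀ k cs → bValue (combine k cs) ≡ pathCost k (finites (firsts cs)) + sumℕ (finites (seconds cs))
bValue-combine k []                     = refl
bValue-combine k ((fin _ , fin b) ∷ []) = sym (+-identityʳ b)
bValue-combine k ((∞     , fin b) ∷ []) = sym (+-identityʳ b)
bValue-combine k ((fin _ , ∞)     ∷ []) = refl
bValue-combine k ((∞     , ∞)     ∷ []) = refl
bValue-combine k cs@(_ ∷ _ ∷ _)         = bCase≡pathCost+ k (finites (firsts cs)) _

+*∸-antitone : ∀ {n p} k d → 1 ≤ d → n ≤ p → p ≤ k → p + d * (k ∸ p) ≤ n + d * (k ∸ n)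
+*∸-antitone {n} {p} k d 1≤d n≤p p≤k = begin
  p + d * (k ∸ p)                 ≡⟨ cong (_+ d * (k ∸ p)) (sym (m+[n∸m]≡n n≤p)) ⟩
  n + (p ∸ n) + d * (k ∸ p)       ≤⟨ +-monoˡ-≤ (d * (k ∸ p)) (+-monoʳ-≤ n (m≤n*m (p ∸ n) d)) ⟩
  n + d * (p ∸ n) + d * (k ∸ p)   ≡⟨ +-assoc n _ _ ⟩
  n + (d * (p ∸ n) + d * (k ∸ p)) ≡⟨ cong (n +_) (sym (*-distribˡ-+ d (p ∸ n) (k ∸ p))) ⟩
  n + d * ((p ∸ n) + (k ∸ p))     ≡⟨ cong (λ e → n + d * e) ∸-split ⟩
  n + d * (k ∸ n)                 ∎
  where
  open ≤-Reasoning
  instance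
    d≢0 : NonZero d
    d≢0 = >-nonZero 1≤d
  ∸-split : (p ∸ n) + (k ∸ p) ≡ k ∸ n
  ∸-split = begin-equality
    (p ∸ n) + (k ∸ p) ≡⟨ +-comm (p ∸ n) (k ∸ p) ⟩
    (k ∸ p) + (p ∸ n) ≡⟨ sym (+-∸-assoc (k ∸ p) n≤p) ⟩
    (k ∸ p) + p ∸ n   ≡⟨ cong (_∸ n) (m∸n+n≡m p≤k) ⟩
    k ∸ n             ∎

branchCost-antitone : ∀ {n m} k d → 1 ≤ d → n ≤ m → branchCost k m d ≤ branchCost k n d
branchCost-antitone {n} {m} k d 1≤d n≤m with m ≤? ⌊ k /2⌋ | n ≤? ⌊ k /2⌋
... | yes m≤h | yes _   = +*∸-antitone k d 1≤d n≤m (≤-trans m≤h (⌊n/2⌋≤n k))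
... | yes m≤h | no  n≰h = ⊥-elim (n≰h (≤-trans n≤m m≤h))
... | no  _   | yes n≤h = subst (λ e → ⌊ k /2⌋ + d * e ≤ n + d * (k ∸ n)) (n∸⌊n/2⌋≡⌈n/2⌉ k)
                            (+*∸-antitone k d 1≤d n≤h (⌊n/2⌋≤n k))
... | no  _   | no  _   = ≤-refl

-- With minimum m and pairwise sums ≥ k, every other entry is at least k ∸ m.
minOf+pairSums≤sum : ∀ k n ns → PairSums≥ k (n ∷ ns) →
  minOf n ns + length ns * (k ∸ minOf n ns) ≤ sumℕ (n ∷ ns)
minOf+pairSums≤sum k n []       _ = ≤-refl
minOf+pairSums≤sum k n (y ∷ ys) ((k≤n+y ∷ k≤n+ys) ∷ (k≤y+ys ∷ pys)) with y ≤? minOf n ys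
... | yes y≤m = begin
  y ⊓ m + suc (length ys) * (k ∸ y ⊓ m) ≡⟨ cong (λ e → e + suc (length ys) * (k ∸ e)) (m≤n⇒m⊓n≡m y≤m) ⟩
  y + length (n ∷ ys) * (k ∸ y)         ≤⟨ +-monoʳ-≤ y (length*≤sum (n ∷ ys) k∸y≤ns) ⟩
  y + (n + sumℕ ys)                     ≡⟨ x∙yz≈y∙xz y n (sumℕ ys) ⟩
  n + (y + sumℕ ys)                     ∎
  where
  open ≤-Reasoning
  m : ℕ
  m = minOf n ys
  k∸y≤ns : All (k ∸ y ≤_) (n ∷ ys)
  k∸y≤ns = All.map (m≤n+o⇒m∸n≤o k y) (subst (k ≤_) (+-comm n y) k≤n+y ∷ k≤y+ys)
... | no y≰m = begin
  y ⊓ m + suc (length ys) * (k ∸ y ⊓ m) ≡⟨ cong (λ e → e + suc (length ys) * (k ∸ e)) (m≥n⇒m⊓n≡n m≤y) ⟩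
  m + ((k ∸ m) + length ys * (k ∸ m))   ≡⟨ x∙yz≈y∙xz m (k ∸ m) _ ⟩
  (k ∸ m) + (m + length ys * (k ∸ m))   ≤⟨ +-mono-≤ k∸m≤y (minOf+pairSums≤sum k n ys (k≤n+ys ∷ pys)) ⟩
  y + (n + sumℕ ys)                     ≡⟨ x∙yz≈y∙xz y n (sumℕ ys) ⟩
  n + (y + sumℕ ys)                     ∎
  where
  open ≤-Reasoning
  m : ℕ
  m = minOf n ys
  m≤y : m ≤ y
  m≤y = <⇒≤ (≰⇒> y≰m)
  k∸y≤m : k ∸ y ≤ m
  k∸y≤m = minOf-greatest (m≤n+o⇒m∸n≤o k y (subst (k ≤_) (+-comm n y) k≤n+y))
                         (All.map (m≤n+o⇒m∸n≤o k y) k≤y+ys)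
  k∸m≤y : k ∸ m ≤ y
  k∸m≤y = m≤n+o⇒m∸n≤o k m (subst (k ≤_) (+-comm y m) (≤-trans (m≤n+m∸n k y) (+-monoʳ-≤ y k∸y≤m)))

branchCost≤sum : ∀ k n ns → PairSums≥ k (n ∷ ns) → branchCost k (minOf n ns) (length ns) ≤ sumℕ (n ∷ ns)
branchCost≤sum k n ns pairs with minOf n ns ≤? ⌊ k /2⌋
... | yes _   = minOf+pairSums≤sum k n ns pairs
... | no  m≰h = begin
  ⌊ k /2⌋ + length ns * ⌈ k /2⌉ ≤⟨ +-mono-≤ (<⇒≤ h<m) (*-monoʳ-≤ (length ns) ⌈k/2⌉≤m) ⟩
  m + length ns * m             ≤⟨ length*≤sum (n ∷ ns) (minOf≤head n ns ∷ minOf≤tail n ns) ⟩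
  sumℕ (n ∷ ns)                 ∎
  where
  open ≤-Reasoning
  m : ℕ
  m = minOf n ns
  h<m : ⌊ k /2⌋ < m
  h<m = ≰⇒> m≰h
  ⌈k/2⌉≤m : ⌈ k /2⌉ ≤ m
  ⌈k/2⌉≤m = ≤-trans (⌈n/2⌉≤1+⌊n/2⌋ k) h<m

pathCost≤sum : ∀ k {ns as} → Pointwise _≤_ ns as → PairSums≥ k ns → pathCost k as ≤ sumℕ ns
pathCost≤sum k []       _ = z≤n
pathCost≤sum k (_ ∷ []) _ = z≤n
pathCost≤sum k {n ∷ n' ∷ ns} {a ∷ a' ∷ as} (n≤a ∷ ns≤as@(_ ∷ ns'≤as')) pairs = begin
  branchCost k (minOf a (a' ∷ as)) (suc (length as))
    ≤⟨ branchCost-antitone k _ (s≤s z≤n) (minOf-mono n≤a ns≤as) ⟩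
  branchCost k (minOf n (n' ∷ ns)) (suc (length as))
    ≡⟨ cong (branchCost k (minOf n (n' ∷ ns)) ∘ suc) (sym (Pointwise-length ns'≤as')) ⟩
  branchCost k (minOf n (n' ∷ ns)) (length (n' ∷ ns))
    ≤⟨ branchCost≤sum k n (n' ∷ ns) pairs ⟩
  sumℕ (n ∷ n' ∷ ns) ∎
  where open ≤-Reasoning

-- Fits (a_u , b_u) n constrains the number n of vertices of a k-metric generator in the subtree of u.
data Fits : ℕ∞ × ℕ∞ → ℕ → Set where
  path      : ∀ {a n} → n ≤ a → Fits (fin a , ∞) n
  branching : ∀ {b n} → b ≤ n → Fits (∞ , fin b) n

pathCounts : ∀ {cs ns} → Pointwise Fits cs ns → List ℕ
pathCounts []                    = []
pathCounts (path {n = n} _ ∷ fs) = n ∷ pathCounts fs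
pathCounts (branching _ ∷ fs)    = pathCounts fs

pathCounts≤ : ∀ {cs ns} (fs : Pointwise Fits cs ns) → Pointwise _≤_ (pathCounts fs) (finites (firsts cs))
pathCounts≤ []                 = []
pathCounts≤ (path n≤a ∷ fs)    = n≤a ∷ pathCounts≤ fs
pathCounts≤ (branching _ ∷ fs) = pathCounts≤ fs

pathCounts+branching≤sum : ∀ {cs ns} (fs : Pointwise Fits cs ns) →
  sumℕ (pathCounts fs) + sumℕ (finites (seconds cs)) ≤ sumℕ ns
pathCounts+branching≤sum []                    = z≤n
pathCounts+branching≤sum (path {n = n} _ ∷ fs) =
  ≤-trans (≤-reflexive (+-assoc n _ _)) (+-monoʳ-≤ n (pathCounts+branching≤sum fs))
pathCounts+branching≤sum (branching {b} b≤n ∷ fs) =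
  ≤-trans (≤-reflexive (x∙yz≈y∙xz (sumℕ (pathCounts fs)) b _)) (+-mono-≤ b≤n (pathCounts+branching≤sum fs))

all-pathCounts : ∀ {P : ℕ → Set} {cs ns} (fs : Pointwise Fits cs ns) → All P ns → All P (pathCounts fs)
all-pathCounts []                 []       = []
all-pathCounts (path _ ∷ fs)      (p ∷ ps) = p ∷ all-pathCounts fs ps
all-pathCounts (branching _ ∷ fs) (_ ∷ ps) = all-pathCounts fs ps

pairSums-pathCounts : ∀ {k cs ns} (fs : Pointwise Fits cs ns) → PairSums≥ k ns → PairSums≥ k (pathCounts fs)
pairSums-pathCounts []                 []       = []
pairSums-pathCounts (path _ ∷ fs)      (h ∷ hs) = all-pathCounts fs h ∷ pairSums-pathCounts fs hs
pairSums-pathCounts (branching _ ∷ fs) (_ ∷ hs) = pairSums-pathCounts fs hs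

bValue-combine≤sum : ∀ k {cs ns} → Pointwise Fits cs ns → PairSums≥ k ns → bValue (combine k cs) ≤ sumℕ ns
bValue-combine≤sum k {cs} {ns} fs pairs = begin
  bValue (combine k cs)                                          ≡⟨ bValue-combine k cs ⟩
  pathCost k (finites (firsts cs)) + sumℕ (finites (seconds cs)) ≤⟨ +-monoˡ-≤ _ pathCost≤pathCounts ⟩
  sumℕ (pathCounts fs) + sumℕ (finites (seconds cs))             ≤⟨ pathCounts+branching≤sum fs ⟩
  sumℕ ns                                                        ∎
  where
  open ≤-Reasoning
  pathCost≤pathCounts : pathCost k (finites (firsts cs)) ≤ sumℕ (pathCounts fs)
  pathCost≤pathCounts = pathCost≤sum k (pathCounts≤ fs) (pairSums-pathCounts fs pairs)

capsFor : ℕ → ℕ → ℕ × ℕ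
capsFor k m with m ≤? ⌊ k /2⌋
... | yes _ = k ∸ m , k ∸ m
... | no  _ = ⌊ k /2⌋ , ⌈ k /2⌉

-- How many vertices to take from the first path child and from each later one.
caps : ℕ → List ℕ → ℕ × ℕ
caps k (x ∷ y ∷ zs) = capsFor k (minOf x (y ∷ zs))
caps k _            = 0 , 0

capped : ℕ × ℕ → List ℕ → List ℕ
capped (cf , cr) []       = []
capped (cf , cr) (x ∷ xs) = x ⊓ cf ∷ map (_⊓ cr) xs

capped-same : ∀ c xs → capped (c , c) xs ≡ map (_⊓ c) xs
capped-same c []       = refl
capped-same c (x ∷ xs) = refl

sum-map-⊓≤ : ∀ K xs → sumℕ (map (_⊓ K) xs) ≤ length xs * K
sum-map-⊓≤ K []       = z≤n
sum-map-⊓≤ K (x ∷ xs) = +-mono-≤ (m⊓n≤n x K) (sum-map-⊓≤ K xs)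

sum-map-⊓≤minOf : ∀ K x xs → minOf x xs ≤ K → x ⊓ K + sumℕ (map (_⊓ K) xs) ≤ minOf x xs + length xs * K
sum-map-⊓≤minOf K x []       _   = +-monoˡ-≤ 0 (m⊓n≤m x K)
sum-map-⊓≤minOf K x (y ∷ ys) m≤K with y ≤? minOf x ys
... | yes y≤m rewrite m≤n⇒m⊓n≡m y≤m = begin
  x ⊓ K + (y ⊓ K + sumℕ (map (_⊓ K) ys)) ≡⟨ x∙yz≈y∙xz (x ⊓ K) (y ⊓ K) _ ⟩
  y ⊓ K + (x ⊓ K + sumℕ (map (_⊓ K) ys)) ≤⟨ +-mono-≤ (m⊓n≤m y K) (sum-map-⊓≤ K (x ∷ ys)) ⟩
  y + (K + length ys * K)                 ∎
  where open ≤-Reasoning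
... | no y≰m rewrite m≥n⇒m⊓n≡n (<⇒≤ (≰⇒> y≰m)) = begin
  x ⊓ K + (y ⊓ K + sumℕ (map (_⊓ K) ys)) ≡⟨ x∙yz≈y∙xz (x ⊓ K) (y ⊓ K) _ ⟩
  y ⊓ K + (x ⊓ K + sumℕ (map (_⊓ K) ys)) ≤⟨ +-mono-≤ (m⊓n≤n y K) (sum-map-⊓≤minOf K x ys m≤K) ⟩
  K + (minOf x ys + length ys * K)        ≡⟨ x∙yz≈y∙xz K (minOf x ys) _ ⟩
  minOf x ys + (K + length ys * K)        ∎
  where open ≤-Reasoning

sum-capped≤pathCost : ∀ k as → sumℕ (capped (caps k as) as) ≤ pathCost k as
sum-capped≤pathCost k []           = z≤n
sum-capped≤pathCost k (x ∷ [])     = ≤-reflexive (trans (+-identityʳ _) (⊓-zeroʳ x))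
sum-capped≤pathCost k (x ∷ y ∷ zs) with minOf x (y ∷ zs) ≤? ⌊ k /2⌋
... | yes m≤h = sum-map-⊓≤minOf _ x (y ∷ zs) (m≤⌊n/2⌋⇒m≤n∸m k m≤h)
... | no  _   = +-mono-≤ (m⊓n≤n x _) (sum-map-⊓≤ _ (y ∷ zs))

⊓+⊓-greatest : ∀ {k a b K L} → k ≤ a + b → k ≤ a + L → k ≤ K + b → k ≤ K + L → k ≤ a ⊓ K + b ⊓ L
⊓+⊓-greatest {k} {a} {b} {K} {L} ab aL Kb KL = subst (k ≤_) (sym (+-distribʳ-⊓ (b ⊓ L) a K))
  (⊓-glb (subst (k ≤_) (sym (+-distribˡ-⊓ a b L)) (⊓-glb ab aL))
         (subst (k ≤_) (sym (+-distribˡ-⊓ K b L)) (⊓-glb Kb KL)))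

module _ {k m cf cr : ℕ} (m+cr : k ≤ m + cr) (cf+m : k ≤ cf + m) (cf+cr : k ≤ cf + cr) (cr+cr : k ≤ cr + cr) where

  private
    capPair : ∀ {a b K} → k ≤ K + m → k ≤ K + cr → m ≤ a → m ≤ b → k ≤ a + b → k ≤ a ⊓ K + b ⊓ cr
    capPair {a} {b} {K} K+m K+cr m≤a m≤b ab =
      ⊓+⊓-greatest {k} {a} {b} {K} {cr} ab (≤-trans m+cr (+-monoˡ-≤ cr m≤a)) (≤-trans K+m (+-monoʳ-≤ K m≤b)) K+cr

    capAll : ∀ {a K} → k ≤ K + m → k ≤ K + cr → m ≤ a →
      ∀ {bs} → All (m ≤_) bs → All (λ b → k ≤ a + b) bs → All (λ b → k ≤ a ⊓ K + b) (map (_⊓ cr) bs)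
    capAll _   _    _   []         []         = []
    capAll K+m K+cr m≤a (m≤b ∷ hs) (ab ∷ abs) = capPair K+m K+cr m≤a m≤b ab ∷ capAll K+m K+cr m≤a hs abs

    capRest : ∀ {xs} → All (m ≤_) xs → PairSums≥ k xs → PairSums≥ k (map (_⊓ cr) xs)
    capRest []         []           = []
    capRest (m≤x ∷ hs) (xs ∷ pairs) = capAll (subst (k ≤_) (+-comm m cr) m+cr) cr+cr m≤x hs xs ∷ capRest hs pairs

  pairSums-capped : ∀ {x xs} → All (m ≤_) (x ∷ xs) → PairSums≥ k (x ∷ xs) →
    PairSums≥ k (capped (cf , cr) (x ∷ xs))
  pairSums-capped (m≤x ∷ hs) (xs ∷ pairs) = capAll cf+m cf+cr m≤x hs xs ∷ capRest hs pairs

pairSums-capped-caps : ∀ k as → PairSums≥ k as → PairSums≥ k (capped (caps k as) as)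
pairSums-capped-caps k []           _     = []
pairSums-capped-caps k (x ∷ [])     _     = [] ∷ []
pairSums-capped-caps k (x ∷ y ∷ zs) pairs with minOf x (y ∷ zs) ≤? ⌊ k /2⌋
... | yes m≤h = pairSums-capped m+[k∸m] (subst (k ≤_) (+-comm m (k ∸ m)) m+[k∸m]) [k∸m]+[k∸m] [k∸m]+[k∸m]
                  (minOf≤head x (y ∷ zs) ∷ minOf≤tail x (y ∷ zs)) pairs
  where
  m : ℕ
  m = minOf x (y ∷ zs)
  m+[k∸m] : k ≤ m + (k ∸ m)
  m+[k∸m] = m≤n+m∸n k m
  [k∸m]+[k∸m] : k ≤ (k ∸ m) + (k ∸ m)
  [k∸m]+[k∸m] = ≤-trans m+[k∸m] (+-monoˡ-≤ (k ∸ m) (m≤⌊n/2⌋⇒m≤n∸m k m≤h))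
... | no  m≰h = pairSums-capped (≤-trans h+C (+-monoˡ-≤ _ (<⇒≤ h<m))) (≤-trans h+C (+-monoʳ-≤ _ C≤m)) h+C
                  (n≤⌈n/2⌉+⌈n/2⌉ k) (minOf≤head x (y ∷ zs) ∷ minOf≤tail x (y ∷ zs)) pairs
  where
  h<m : ⌊ k /2⌋ < minOf x (y ∷ zs)
  h<m = ≰⇒> m≰h
  h+C : k ≤ ⌊ k /2⌋ + ⌈ k /2⌉
  h+C = ≤-reflexive (sym (⌊n/2⌋+⌈n/2⌉≡n k))
  C≤m : ⌈ k /2⌉ ≤ minOf x (y ∷ zs)
  C≤m = ≤-trans (⌈n/2⌉≤1+⌊n/2⌋ k) h<m

-- The upper bound

Family : List RTree → Set
Family = All (λ t → List (Pos t))

flatten : ∀ {ts} → Family ts → List (PosL ts)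
flatten []      = []
flatten (X ∷ F) = map hd X ++ map tl (flatten F)

sizes : ∀ {ts} → Family ts → List ℕ
sizes []      = []
sizes (X ∷ F) = length X ∷ sizes F

Each : (∀ {t} → List (Pos t) → Set) → ∀ {ts} → Family ts → Set
Each Q []      = ⊤
Each Q (X ∷ F) = Q X × Each Q F

length-flatten : ∀ {ts} (F : Family ts) → length (flatten F) ≡ sumℕ (sizes F)
length-flatten []      = refl
length-flatten (X ∷ F) = trans (length-++ (map hd X))
  (cong₂ _+_ (length-map hd X) (trans (length-map tl (flatten F)) (length-flatten F)))

length-sizes : ∀ {ts} (F : Family ts) → length (sizes F) ≡ length ts
length-sizes []      = refl
length-sizes (X ∷ F) = cong suc (length-sizes F)

unique-flatten : ∀ {ts} (F : Family ts) → Each Unique F → Unique (flatten F)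
unique-flatten []      _         = []
unique-flatten (X ∷ F) (uX , uF) =
  Unique.++⁺ (Unique.map⁺ hd-injective uX) (Unique.map⁺ tl-injective (unique-flatten F uF)) disjoint
  where
  hd-injective : ∀ {t ts} {x y : Pos t} → hd {ts = ts} x ≡ hd y → x ≡ y
  hd-injective refl = refl
  tl-injective : ∀ {t ts} {x y : PosL ts} → tl {t = t} x ≡ tl y → x ≡ y
  tl-injective refl = refl
  disjoint : ∀ {v} → ¬ (v ∈ map hd X × v ∈ map tl (flatten F))
  disjoint (v∈hds , v∈tls) with ∈-map⁻ hd v∈hds | ∈-map⁻ tl v∈tls
  ... | _ , _ , refl | _ , _ , ()

spine : (t : RTree) → ℕ → List (Pos t)
spine (node ts)       zero    = []
spine (node [])       (suc n) = here ∷ []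
spine (node (t ∷ ts)) (suc n) = here ∷ map (child ∘ hd) (spine t n)

length-spine : ∀ {t a} → IsPath t a → ∀ n → length (spine t n) ≡ a ⊓ n
length-spine leaf         zero    = refl
length-spine leaf         (suc n) = refl
length-spine (cons p)     zero    = refl
length-spine (cons {t} p) (suc n) = cong suc (trans (length-map (child ∘ hd) (spine t n)) (length-spine p n))

unique-spine : ∀ t n → Unique (spine t n)
unique-spine (node ts)       zero    = []
unique-spine (node [])       (suc n) = [] ∷ []
unique-spine (node (t ∷ ts)) (suc n) =
  All.map⁺ (All.universal (λ _ ()) (spine t n)) ∷ Unique.map⁺ child-hd-injective (unique-spine t n)
  where
  child-hd-injective : ∀ {x y : Pos t} → child {t ∷ ts} (hd x) ≡ child (hd y) → x ≡ y
  child-hd-injective refl = refl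

basis       : ℕ → (t : RTree) → List (Pos t)
basisFamily : ℕ → ℕ × ℕ → (ts : List RTree) → Family ts
basisChild  : ℕ → ℕ × ℕ → (t : RTree) (ts : List RTree) → ℕ∞ → Family (t ∷ ts)
basis k (node ts) = map child (flatten (basisFamily k (caps k (pathLengths k ts)) ts))
basisFamily k cap []       = []
basisFamily k cap (t ∷ ts) = basisChild k cap t ts (proj₁ (alg k t))
basisChild k (cf , cr) t ts (fin _) = spine t cf ∷ basisFamily k (cr , cr) ts
basisChild k cap       t ts ∞       = basis k t ∷ basisFamily k cap ts

unique-basis       : ∀ k t → Unique (basis k t)
unique-basisFamily : ∀ k cap ts → Each Unique (basisFamily k cap ts)
unique-basisChild  : ∀ k cap t ts x → Each Unique (basisChild k cap t ts x)
unique-basis k (node ts) = Unique.map⁺ child-injective (unique-flatten _ (unique-basisFamily k _ ts))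
unique-basisFamily k cap []       = tt
unique-basisFamily k cap (t ∷ ts) = unique-basisChild k cap t ts (proj₁ (alg k t))
unique-basisChild k (cf , cr) t ts (fin _) = unique-spine t cf , unique-basisFamily k (cr , cr) ts
unique-basisChild k cap       t ts ∞       = unique-basis k t , unique-basisFamily k cap ts

length-basis-node : ∀ k ts → length (basis k (node ts)) ≡ sumℕ (sizes (basisFamily k (caps k (pathLengths k ts)) ts))
length-basis-node k ts = trans (length-map child (flatten F)) (length-flatten F)
  where
  F : Family ts
  F = basisFamily k (caps k (pathLengths k ts)) ts

length-basis       : ∀ k t → length (basis k t) ≤ bValue (alg k t)
length-basisFamily : ∀ k cap ts →
  sumℕ (sizes (basisFamily k cap ts)) ≤ sumℕ (capped cap (pathLengths k ts)) + sumℕ (finites (seconds (algL k ts)))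
length-basis k (node ts) = begin
  length (basis k (node ts))                                 ≡⟨ length-basis-node k ts ⟩
  sumℕ (sizes (basisFamily k (caps k as) ts))                ≤⟨ length-basisFamily k _ ts ⟩
  sumℕ (capped (caps k as) as) + sumℕ (finites (seconds cs)) ≤⟨ +-monoˡ-≤ _ (sum-capped≤pathCost k as) ⟩
  pathCost k as + sumℕ (finites (seconds cs))                ≡⟨ sym (bValue-combine k cs) ⟩
  bValue (alg k (node ts))                                   ∎
  where
  open ≤-Reasoning
  as : List ℕ
  as = pathLengths k ts
  cs : List (ℕ∞ × ℕ∞)
  cs = algL k ts
length-basisFamily k cap       []       = z≤n
length-basisFamily k (cf , cr) (t ∷ ts) with alg-path⊎branching k t
... | inj₁ (a , p , e) rewrite e | length-spine p cf =
  ≤-trans (+-monoʳ-≤ (a ⊓ cf) (subst (λ xs → sumℕ (sizes (basisFamily k (cr , cr) ts)) ≤ sumℕ xs + s)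
                                      (capped-same cr (pathLengths k ts)) (length-basisFamily k (cr , cr) ts)))
          (≤-reflexive (sym (+-assoc (a ⊓ cf) _ s)))
  where
  s : ℕ
  s = sumℕ (finites (seconds (algL k ts)))
... | inj₂ (b , e) rewrite e =
  ≤-trans (+-mono-≤ (subst (λ c → length (basis k t) ≤ bValue c) e (length-basis k t))
                    (length-basisFamily k (cf , cr) ts))
          (≤-reflexive (x∙yz≈y∙xz b (sumℕ (capped (cf , cr) (pathLengths k ts))) s))
  where
  s : ℕ
  s = sumℕ (finites (seconds (algL k ts)))

branchSize : ∀ {ts} → PosL ts → Family ts → ℕ
branchSize (hd _) (X ∷ F) = length X
branchSize (tl p) (X ∷ F) = branchSize p F

all-branchSize : ∀ {ts} {P : ℕ → Set} (p : PosL ts) (F : Family ts) → All P (sizes F) → P (branchSize p F)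
all-branchSize (hd _) (X ∷ F) (h ∷ _)  = h
all-branchSize (tl p) (X ∷ F) (_ ∷ hs) = all-branchSize p F hs

pairSums-branchSize : ∀ {k ts} (F : Family ts) → PairSums≥ k (sizes F) →
  ∀ p q → ¬ SameBranch p q → k ≤ branchSize p F + branchSize q F
pairSums-branchSize     (X ∷ F) _        (hd _) (hd _) nb = ⊥-elim (nb tt)
pairSums-branchSize     (X ∷ F) (h ∷ _)  (hd _) (tl q) _  = all-branchSize q F h
pairSums-branchSize {k} (X ∷ F) (h ∷ _)  (tl p) (hd _) _  = subst (k ≤_) (+-comm (length X) _) (all-branchSize p F h)
pairSums-branchSize     (X ∷ F) (_ ∷ hs) (tl p) (tl q) nb = pairSums-branchSize F hs p q nb

count-flatten : ∀ {t ts} {P : Pred (PosL (t ∷ ts)) 0ℓ} (P? : Decidable P) X (F : Family ts) →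
  count P? (flatten (X ∷ F)) ≡ count (P? ∘ hd) X + count (P? ∘ tl) (flatten F)
count-flatten P? X F = trans (count-++ P? (map hd X) (map tl (flatten F)))
  (cong₂ _+_ (count-map P? hd X) (count-map P? tl (flatten F)))

branchSize≤count : ∀ {ts} {P : Pred (PosL ts) 0ℓ} (P? : Decidable P) p (F : Family ts) →
  (∀ s → SameBranch p s → P s) → branchSize p F ≤ count P? (flatten F)
branchSize≤count P? (hd _) (X ∷ F) h = begin
  length X                                            ≡⟨ sym (count-universal (P? ∘ hd) (λ y → h (hd y) tt) X) ⟩
  count (P? ∘ hd) X                                   ≤⟨ m≤m+n _ _ ⟩
  count (P? ∘ hd) X + count (P? ∘ tl) (flatten F)     ≡⟨ sym (count-flatten P? X F) ⟩
  count P? (flatten (X ∷ F))                          ∎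
  where open ≤-Reasoning
branchSize≤count P? (tl p) (X ∷ F) h = begin
  branchSize p F                                      ≤⟨ branchSize≤count (P? ∘ tl) p F (h ∘ tl) ⟩
  count (P? ∘ tl) (flatten F)                         ≤⟨ m≤n+m _ _ ⟩
  count (P? ∘ hd) X + count (P? ∘ tl) (flatten F)     ≡⟨ sym (count-flatten P? X F) ⟩
  count P? (flatten (X ∷ F))                          ∎
  where open ≤-Reasoning

twoBranches≤count : ∀ {ts} {P : Pred (PosL ts) 0ℓ} (P? : Decidable P) p q (F : Family ts) → ¬ SameBranch p q →
  (∀ s → SameBranch p s ⊎ SameBranch q s → P s) → branchSize p F + branchSize q F ≤ count P? (flatten F)
twoBranches≤count P? (hd _) (hd _) F       nb h = ⊥-elim (nb tt)
twoBranches≤count P? (hd _) (tl q) (X ∷ F) nb h = begin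
  length X + branchSize q F
    ≡⟨ cong (_+ branchSize q F) (sym (count-universal (P? ∘ hd) (λ y → h (hd y) (inj₁ tt)) X)) ⟩
  count (P? ∘ hd) X + branchSize q F
    ≤⟨ +-monoʳ-≤ _ (branchSize≤count (P? ∘ tl) q F (λ s → h (tl s) ∘ inj₂)) ⟩
  count (P? ∘ hd) X + count (P? ∘ tl) (flatten F)
    ≡⟨ sym (count-flatten P? X F) ⟩
  count P? (flatten (X ∷ F)) ∎
  where open ≤-Reasoning
twoBranches≤count P? (tl p) (hd x) (X ∷ F) nb h =
  subst (_≤ count P? (flatten (X ∷ F))) (+-comm (length X) (branchSize p F))
        (twoBranches≤count P? (hd x) (tl p) (X ∷ F) (λ ()) (λ s → h s ∘ swap))
twoBranches≤count P? (tl p) (tl q) (X ∷ F) nb h = begin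
  branchSize p F + branchSize q F                     ≤⟨ twoBranches≤count (P? ∘ tl) p q F nb (h ∘ tl) ⟩
  count (P? ∘ tl) (flatten F)                         ≤⟨ m≤n+m _ _ ⟩
  count (P? ∘ hd) X + count (P? ∘ tl) (flatten F)     ≡⟨ sym (count-flatten P? X F) ⟩
  count P? (flatten (X ∷ F))                          ∎
  where open ≤-Reasoning

ResolvesLevels : ℕ → ∀ {t} → List (Pos t) → Set
ResolvesLevels k {t} S = ∀ (u v : Pos t) → u ≢ v → depth u ≡ depth v → k ≤ nDist u v S

path-resolvesLevels : ∀ {k t a} → IsPath t a → (S : List (Pos t)) → ResolvesLevels k S
path-resolvesLevels p S u v u≢v du≡dv = ⊥-elim (u≢v (path-depth-injective p u v du≡dv))

nDistL : ∀ {ts} → PosL ts → PosL ts → List (PosL ts) → ℕ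
nDistL p q = count (λ s → ¬? (distL p s ≟ distL q s))

nDist-child : ∀ {ts} (p q : PosL ts) L → nDist (child p) (child q) (map child L) ≡ nDistL p q L
nDist-child p q = count-map (λ s → ¬? (dist (child p) s ≟ dist (child q) s)) child

nDist-sym : ∀ {t} (u v : Pos t) S → nDist u v S ≡ nDist v u S
nDist-sym u v S = cong length (filter-≐ _ _ ((λ ne → ne ∘ sym) , (λ ne → ne ∘ sym)) S)

otherBranches-resolve : ∀ {k ts} (F : Family ts) → PairSums≥ k (sizes F) →
  ∀ p q → ¬ SameBranch p q → depthL p ≡ depthL q → k ≤ nDistL p q (flatten F)
otherBranches-resolve F pairs p q nb e =
  ≤-trans (pairSums-branchSize F pairs p q nb) (twoBranches≤count _ p q F nb distinguishes)
  where
  distinguishes : ∀ s → SameBranch p s ⊎ SameBranch q s → distL p s ≢ distL q s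
  distinguishes s (inj₁ ps) = <⇒≢ (distL-sameBranch-< p q s (≤-reflexive e) ps (λ qs → nb (sameBranch-join p q s ps qs)))
  distinguishes s (inj₂ qs) =
    ≢-sym (<⇒≢ (distL-sameBranch-< q p s (≤-reflexive (sym e)) qs (λ ps → nb (sameBranch-join p q s ps qs))))

resolvesLevels-flatten : ∀ {k ts} (F : Family ts) → Each (ResolvesLevels k) F → PairSums≥ k (sizes F) →
  ∀ p q → p ≢ q → depthL p ≡ depthL q → k ≤ nDistL p q (flatten F)
resolvesLevels-flatten (X ∷ F) (rX , _) _ (hd p) (hd q) ne e =
  ≤-trans (rX p q (ne ∘ cong hd) e)
          (≤-trans (m≤m+n _ _) (≤-reflexive (sym (count-flatten _ X F))))
resolvesLevels-flatten (X ∷ F) (_ , rF) (_ ∷ pairs) (tl p) (tl q) ne e =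
  ≤-trans (resolvesLevels-flatten F rF pairs p q (ne ∘ cong tl) e)
          (≤-trans (m≤n+m _ _) (≤-reflexive (sym (count-flatten _ X F))))
resolvesLevels-flatten F _ pairs p@(hd _) q@(tl _) _ e = otherBranches-resolve F pairs p q (λ ()) e
resolvesLevels-flatten F _ pairs p@(tl _) q@(hd _) _ e = otherBranches-resolve F pairs p q (λ ()) e

resolvesLevels-node : ∀ {k ts} (F : Family ts) → Each (ResolvesLevels k) F → PairSums≥ k (sizes F) →
  ResolvesLevels k (map child (flatten F))
resolvesLevels-node F rF pairs here      here      ne _ = ⊥-elim (ne refl)
resolvesLevels-node F rF pairs (child p) (child q) ne e =
  subst (_ ≤_) (sym (nDist-child p q (flatten F))) (resolvesLevels-flatten F rF pairs p q (ne ∘ cong child) (suc-injective e))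

twoOtherBranches : ∀ {t₁ t₂ t₃ ts} (q : PosL (t₁ ∷ t₂ ∷ t₃ ∷ ts)) →
  ∃[ r ] ∃[ r' ] ¬ SameBranch r r' × ¬ SameBranch q r × ¬ SameBranch q r'
twoOtherBranches (hd _)      = tl (hd (root _)) , tl (tl (hd (root _))) , (λ ()) , (λ ()) , (λ ())
twoOtherBranches (tl (hd _)) = hd (root _) , tl (tl (hd (root _))) , (λ ()) , (λ ()) , (λ ())
twoOtherBranches (tl (tl _)) = hd (root _) , tl (hd (root _)) , (λ ()) , (λ ()) , (λ ())

resolvesDepths-root : ∀ {k t₁ t₂ t₃ ts} (F : Family (t₁ ∷ t₂ ∷ t₃ ∷ ts)) → PairSums≥ k (sizes F) →
  ∀ u q → depth u ≤ depthL q → k ≤ nDist u (child q) (map child (flatten F))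
resolvesDepths-root F pairs u q du≤dq with twoOtherBranches q
... | r , r' , ¬rr' , ¬qr , ¬qr' =
  ≤-trans (pairSums-branchSize F pairs r r' ¬rr')
  (≤-trans (twoBranches≤count _ r r' F ¬rr' distinguishes)
           (≤-reflexive (sym (count-map (λ s → ¬? (dist u s ≟ dist (child q) s)) child (flatten F)))))
  where
  distinguishes : ∀ s → SameBranch r s ⊎ SameBranch r' s → dist u (child s) ≢ distL q s
  distinguishes s (inj₁ rs)  = <⇒≢ (dist-<-otherBranch u q s du≤dq (λ qs → ¬qr (sameBranch-join q r s qs rs)))
  distinguishes s (inj₂ r's) = <⇒≢ (dist-<-otherBranch u q s du≤dq (λ qs → ¬qr' (sameBranch-join q r' s qs r's)))

data WithLarge (k : ℕ) : List ℕ → List ℕ → Set where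
  []    : WithLarge k [] []
  keep  : ∀ {x xs ps} → WithLarge k xs ps → WithLarge k (x ∷ xs) (x ∷ ps)
  large : ∀ {x xs ps} → k ≤ x → WithLarge k xs ps → WithLarge k (x ∷ xs) ps

all-withLarge : ∀ {k p xs ps} → WithLarge k xs ps → All (λ b → k ≤ p + b) ps → All (λ b → k ≤ p + b) xs
all-withLarge []                        []       = []
all-withLarge (keep w)                  (h ∷ hs) = h ∷ all-withLarge w hs
all-withLarge {p = p} (large {x} k≤x w) hs       = ≤-trans k≤x (m≤n+m x p) ∷ all-withLarge w hs

pairSums-withLarge : ∀ {k xs ps} → WithLarge k xs ps → PairSums≥ k ps → PairSums≥ k xs
pairSums-withLarge []                []       = []
pairSums-withLarge (keep w)          (h ∷ hs) = all-withLarge w h ∷ pairSums-withLarge w hs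
pairSums-withLarge (large {x} k≤x w) hs       = All.universal (λ b → ≤-trans k≤x (m≤m+n x b)) _ ∷ pairSums-withLarge w hs

IsLarge : ℕ → RTree → Set
IsLarge k t = ∀ {b} → alg k t ≡ (∞ , fin b) → k ≤ length (basis k t)

Sound : ℕ → RTree → Set
Sound k t = ResolvesLevels k (basis k t) × IsLarge k t

module _ (k : ℕ) where

  sizes-withLarge : ∀ cap ts → All (IsLarge k) ts →
    WithLarge k (sizes (basisFamily k cap ts)) (capped cap (pathLengths k ts))
  sizes-withLarge cap       []       []       = []
  sizes-withLarge (cf , cr) (t ∷ ts) (l ∷ ls) with alg-path⊎branching k t
  ... | inj₁ (a , p , e) rewrite e | length-spine p cf =
    keep (subst (WithLarge k _) (capped-same cr (pathLengths k ts)) (sizes-withLarge (cr , cr) ts ls))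
  ... | inj₂ (b , e) with l e
  ...   | k≤size rewrite e = large k≤size (sizes-withLarge (cf , cr) ts ls)

  each-resolvesLevels : ∀ cap ts → All (Sound k) ts → Each (ResolvesLevels k) (basisFamily k cap ts)
  each-resolvesLevels cap       []       []       = tt
  each-resolvesLevels (cf , cr) (t ∷ ts) (s ∷ ss) with alg-path⊎branching k t
  ... | inj₁ (a , p , e) rewrite e = path-resolvesLevels p (spine t cf) , each-resolvesLevels (cr , cr) ts ss
  ... | inj₂ (b , e)     rewrite e = proj₁ s , each-resolvesLevels (cf , cr) ts ss

  pairSums-basisFamily : ∀ ts → PairSums≥ k (pathLengths k ts) → All (IsLarge k) ts →
    PairSums≥ k (sizes (basisFamily k (caps k (pathLengths k ts)) ts))
  pairSums-basisFamily ts pairs ls =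
    pairSums-withLarge (sizes-withLarge _ ts ls) (pairSums-capped-caps k (pathLengths k ts) pairs)

  large-node : ∀ ts → PairSums≥ k (pathLengths k ts) → All (Sound k) ts → IsLarge k (node ts)
  large-node []                 _     _        ()
  large-node (t ∷ [])           _     (s ∷ []) e with alg-path⊎branching k t
  ... | inj₁ (a , _ , e') with () ← trans (sym (cong (suc∞ ∘ proj₁) e')) (cong proj₁ e)
  ... | inj₂ (b , e') with proj₂ s e'
  ...   | k≤size rewrite length-basis-node k (t ∷ []) | e' = ≤-trans k≤size (≤-reflexive (sym (+-identityʳ _)))
  large-node ts@(_ ∷ _ ∷ _) pairs sound _ rewrite length-basis-node k ts =
    pairSums≤sum (subst (2 ≤_) (sym (length-sizes F)) (s≤s (s≤s z≤n)))
                 (pairSums-basisFamily ts pairs (All.map proj₂ sound))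
    where
    F : Family ts
    F = basisFamily k (caps k (pathLengths k ts)) ts

  basis-sound    : ∀ {t} → k ≤ς-locally t → Sound k t
  children-sound : ∀ {ts} → All (k ≤ς-locally_) ts → All (Sound k) ts
  basis-sound {node ts} (node pairs locals) =
    resolvesLevels-node _ (each-resolvesLevels _ ts sound) (pairSums-basisFamily ts pairs (All.map proj₂ sound)) ,
    large-node ts pairs sound
    where
    sound : All (Sound k) ts
    sound = children-sound locals
  children-sound []       = []
  children-sound (l ∷ ls) = basis-sound l ∷ children-sound ls

  basis-resolvesDepths : ∀ {t₁ t₂ t₃ ts} → let T = node (t₁ ∷ t₂ ∷ t₃ ∷ ts) in
    k ≤ς-locally T → ∀ u v → depth u < depth v → k ≤ nDist u v (basis k T)
  basis-resolvesDepths (node pairs locals) u (child q) du<dv =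
    resolvesDepths-root _ (pairSums-basisFamily _ pairs (All.map proj₂ (children-sound locals))) u q (≤-pred du<dv)

  basis-generates : ∀ {t₁ t₂ t₃ ts} → let T = node (t₁ ∷ t₂ ∷ t₃ ∷ ts) in
    k ≤ς-locally T → ∀ u v → u ≢ v → k ≤ nDist u v (basis k T)
  basis-generates {t₁} {t₂} {t₃} {ts} local u v u≢v with <-cmp (depth u) (depth v)
  ... | tri< du<dv _ _ = basis-resolvesDepths local u v du<dv
  ... | tri≈ _ du≡dv _ = proj₁ (basis-sound local) u v u≢v du≡dv
  ... | tri> _ _ dv<du =
    subst (k ≤_) (nDist-sym v u (basis k (node (t₁ ∷ t₂ ∷ t₃ ∷ ts)))) (basis-resolvesDepths local v u dv<du)

-- The lower bound

childPos : ∀ {ts} → Pos (node ts) → Maybe (PosL ts)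
childPos here      = nothing
childPos (child p) = just p

tailPos : ∀ {t ts} → PosL (t ∷ ts) → Maybe (PosL ts)
tailPos (hd _) = nothing
tailPos (tl p) = just p

sum-restrictL : ∀ ts (L : List (PosL ts)) →
  sumℕ (mapWith∈ ts (λ σ → length (mapMaybe (restrictL σ) L))) ≡ length L
sum-restrictL []       []      = refl
sum-restrictL (t ∷ ts) L = begin
  length (mapMaybe (restrictL (here refl)) L) + sumℕ (mapWith∈ ts (λ σ → length (mapMaybe (restrictL (there σ)) L)))
    ≡⟨ cong (length (mapMaybe (restrictL (here refl)) L) +_)
         (trans (cong sumℕ (mapWith∈-cong ts _ _ λ σ → cong length (mapMaybe-there σ)))
                (sum-restrictL ts (mapMaybe tailPos L))) ⟩
  length (mapMaybe (restrictL (here refl)) L) + length (mapMaybe tailPos L)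
    ≡⟨ split L ⟩
  length L ∎
  where
  open ≡-Reasoning
  mapMaybe-there : ∀ {t'} (σ : t' ∈ ts) → mapMaybe (restrictL (there σ)) L ≡ mapMaybe (restrictL σ) (mapMaybe tailPos L)
  mapMaybe-there σ = trans (mapMaybe-cong (λ { (hd _) → refl ; (tl _) → refl }) L) (mapMaybe->>= tailPos (restrictL σ) L)
  split : ∀ L → length (mapMaybe (restrictL (here refl)) L) + length (mapMaybe tailPos L) ≡ length L
  split []         = refl
  split (hd _ ∷ L) = cong suc (split L)
  split (tl _ ∷ L) = trans (+-suc _ _) (cong suc (split L))

sum-restrict≤ : ∀ ts (X : List (Pos (node ts))) →
  sumℕ (mapWith∈ ts (λ σ → length (mapMaybe (restrict σ) X))) ≤ length X
sum-restrict≤ ts X = begin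
  sumℕ (mapWith∈ ts (λ σ → length (mapMaybe (restrict σ) X)))
    ≡⟨ cong sumℕ (mapWith∈-cong ts _ _ λ σ → cong length
         (trans (mapMaybe-cong (λ { here → refl ; (child _) → refl }) X) (mapMaybe->>= childPos (restrictL σ) X))) ⟩
  sumℕ (mapWith∈ ts (λ σ → length (mapMaybe (restrictL σ) (mapMaybe childPos X))))
    ≡⟨ sum-restrictL ts (mapMaybe childPos X) ⟩
  length (mapMaybe childPos X)
    ≤⟨ length-mapMaybe childPos X ⟩
  length X ∎
  where open ≤-Reasoning

module LowerBound {T : RTree} {k : ℕ} (S : List (Pos T)) (uniqueS : Unique S)
                  (generates : ∀ u v → u ≢ v → k ≤ nDist u v S) where

  inside : ∀ {t} → Ctx T t → List (Pos t)
  inside c = mapMaybe (unplug c) S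

  inside-down : ∀ {t ts} (c : Ctx T (node ts)) (σ : t ∈ ts) → inside (down c σ) ≡ mapMaybe (restrict σ) (inside c)
  inside-down c σ = mapMaybe->>= (unplug c) (restrict σ) S

  unique-inside : ∀ {t} (c : Ctx T t) → Unique (inside c)
  unique-inside c = unique-mapMaybe (unplug c) (λ ex ey → trans (sym (plug-unplug c _ ex)) (plug-unplug c _ ey)) uniqueS

  -- Only vertices inside the two subtrees tell two sibling roots apart.
  siblings-cover : ∀ {ts us us'} (c : Ctx T (node ts)) (σ : node us ∈ ts) (τ : node us' ∈ ts) → index σ ≢ index τ →
    k ≤ length (inside (down c σ)) + length (inside (down c τ))
  siblings-cover c σ τ ne = ≤-trans (generates u v u≢v)
    (count-≤-mapMaybe₂ (λ s → ¬? (dist u s ≟ dist v s)) (unplug (down c σ)) (unplug (down c τ)) inOne S)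
    where
    u v : Pos T
    u = plug (down c σ) here
    v = plug (down c τ) here
    u≢v : u ≢ v
    u≢v = embed-sibling σ τ ne here here ∘ child-injective ∘ plug-injective c
    inOne : ∀ s → dist u s ≢ dist v s → Is-just (unplug (down c σ) s) ⊎ Is-just (unplug (down c τ) s)
    inOne s du≢dv with unplug (down c σ) s in eσ | unplug (down c τ) s in eτ
    ... | just _  | _       = inj₁ (is-just tt)
    ... | nothing | just _  = inj₂ (is-just tt)
    ... | nothing | nothing =
      ⊥-elim (du≢dv (trans (dist-childRoot-outside c σ s eσ) (sym (dist-childRoot-outside c τ s eτ))))

  LowerBoundAt : RTree → Set
  LowerBoundAt t = (c : Ctx T t) → bValue (alg k t) ≤ length (inside c)

  lowerBound : ∀ t → LowerBoundAt t
  lowerBound = treeInduction LowerBoundAt step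
    where
    step : ∀ {ts} → All LowerBoundAt ts → LowerBoundAt (node ts)
    step {ts} ih c = begin
      bValue (combine k (algL k ts))                                       ≤⟨ bValue-combine≤sum k fits pairs ⟩
      sumℕ counts                                                          ≡⟨ cong sumℕ (mapWith∈-cong ts _ _
                                                                                (cong length ∘ inside-down c)) ⟩
      sumℕ (mapWith∈ ts (λ σ → length (mapMaybe (restrict σ) (inside c)))) ≤⟨ sum-restrict≤ ts (inside c) ⟩
      length (inside c)                                                    ∎
      where
      open ≤-Reasoning
      counts : List ℕ
      counts = mapWith∈ ts (λ σ → length (inside (down c σ)))
      fit : ∀ {t} (σ : t ∈ ts) → Fits (alg k t) (length (inside (down c σ)))
      fit {t} σ with alg-path⊎branching k t | All.lookup ih σ (down c σ)
      ... | inj₁ (a , p , e) | _  rewrite e = path (unique-≤-pathLength p (unique-inside (down c σ)))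
      ... | inj₂ (b , e)     | lb rewrite e = branching lb
      fits : Pointwise Fits (algL k ts) counts
      fits = subst (λ cs → Pointwise Fits cs counts) (sym (algL≡map k ts)) (pointwise-mapWith∈ ts _ fit)
      pairs : PairSums≥ k counts
      pairs = allPairs-mapWith∈ _ λ { {node us} {node us'} σ τ ne → siblings-cover c σ τ ne }

-- NotPath T follows from IsMajor (root T), and the argument works for every k.
mainTheorem10 : (T : RTree) → NotPath T → IsMajor (root T) →
    (k : ℕ) → 1 ≤ k → k ≤ς T →
    ∃[ m ] (bRoot k T ≡ fin m × IsKMetricDim k T m)
mainTheorem10 (node [])                _ ()             _ _ _
mainTheorem10 (node (_ ∷ []))          _ (s≤s ())       _ _ _
mainTheorem10 (node (_ ∷ _ ∷ []))      _ (s≤s (s≤s ())) _ _ _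
mainTheorem10 T@(node (_ ∷ _ ∷ _ ∷ _)) _ major k _ k≤ςT =
  bValue (alg k T) , refl , (basis k T , generator , ≤-antisym (length-basis k T) (lower _ generator)) , lower
  where
  generator : IsKMetricGenerator k T (basis k T)
  generator = unique-basis k T , basis-generates k (LocalςBound.local k≤ςT T top (λ _ → major))
  lower : ∀ S → IsKMetricGenerator k T S → bValue (alg k T) ≤ length S
  lower S (uniqueS , generates) =
    subst (λ X → bValue (alg k T) ≤ length X) (mapMaybe-just S) (LowerBound.lowerBound S uniqueS generates T top)
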